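{- Let $S$ be a variable preserving term equation system over a ranked alphabet $\Sigma$, let $p,q\in T_\Sigma$, and let $W_i$ ($i\ge1$) be the ground term equation systems defined in the context. For any $i\ge1$, any $1\le n\le i$ and any $t_1,\dots,t_n\in T_\Sigma$: if $p\Leftrightarrow_S t_1\Leftrightarrow_S\cdots\Leftrightarrow_S t_n$, then $p\Leftrightarrow^*_{W_i}t_1\Leftrightarrow^*_{W_i}\cdots\Leftrightarrow^*_{W_i}t_n$; and if $q\Leftrightarrow_S t_1\Leftrightarrow_S\cdots\Leftrightarrow_S t_n$, then $q\Leftrightarrow^*_{W_i}t_1\Leftrightarrow^*_{W_i}\cdots\Leftrightarrow^*_{W_i}t_n$.
   Context: Notation. $\Sigma$ is a ranked alphabet ($\Sigma_m$: symbols of rank $m$), $T_\Sigma$ the ground terms, $X_m=\{x_1,\dots,x_m\}$, $T_\Sigma(X_m)$ terms with variables in $X_m$; $t[t_1,\dots,t_m]$ replaces each $x_j$ by $t_j$. A context is a term $u\in T_\Sigma(X_1)$ with exactly one occurrence of $x_1$; $u[s]$ replaces $x_1$ by $s$. A TES $S$ is a finite set of equations $l\approx r$ of terms; it is variable preserving if $l$ and $r$ contain the same variables in each equation, which is then written with $l,r\in T_\Sigma(X_m)$. For ground $s,t$, $s\Leftrightarrow_S t$ means $\{s,t\}=\{u[l[u_1,\dots,u_m]],u[r[u_1,\dots,u_m]]\}$ for some equation $l\approx r$ of $S$, context $u$ and ground $u_1,\dots,u_m$. A GTES $E$ is a finite set of equations between ground terms; $\Leftrightarrow_E$ and $\Leftrightarrow^*_E$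 (reflexive transitive closure) are defined in the same way. Congruence class computing tree automaton associated with a GTES $E$ and ground terms $p,q$: $T$ is the set of all subterms of $p$, $q$ and of both sides of all equations of $E$; $\Theta=\Leftrightarrow^*_E\cap(T\times T)$ with classes $[t]_\Theta$; states $A=\{[t]_\Theta:t\in T\}$ (new constants); rules $R=\{f([t_1]_\Theta,\dots,[t_m]_\Theta)\to[f(t_1,\dots,t_m)]_\Theta : f(t_1,\dots,t_m)\in T\}$; $\to^*_R$ is rewriting with $R$ on terms over $\Sigma\cup A$. For each $a\in A$ a ground term $tree(a)\in T_\Sigma$ with $tree(a)\to^*_R a$ is fixed (computed by a fixed deterministic effective algorithm). The automaton reaches $b$ starting from $c$ if $u[c]\to^*_R b$ for some context $u$ ($u=x_1$ allowed). $W_1$ is the set of ground equations $l[u_1,\dots,u_m]\approx r[u_1,\dots,u_m]$ ($l\approx r\in S$, $u_j\in T_\Sigma$) such that $l[u_1,\dots,u_m]$ or $r[u_1,\dots,u_m]$ is a subterm of $p$ or of $q$. For $i\ge1$, with $A_i,R_i,\Theta_i,tree_i$ the data of the automaton associated with the GTES $W_i$ and $p,q$, $W_{i+1}$ consists of $W_i$ together with every equation $l[tree_i(a_1),\dots,tree_i(a_m)]\approx r[tree_i(a_1),\dots,tree_i(a_m)]$ with $l\approx r\in S$, $a_1,\dots,a_m,a\in A_i$ such that (1) $l[a_1,\dots,a_m]\to^*_{R_i}a$ or $r[a_1,\dots,a_m]\to^*_{R_i}a$, (2) the automaton reaches $[p]_{\Theta_i}$ or $[q]_{\Theta_i}$ starting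 from $a$, (3) the pair of the two sides is not in $\Leftrightarrow^*_{W_i}$. -}

module Defs where

open import Data.Nat using (ℕ; zero; suc; _<_)
open import Data.Fin using (Fin)
open import Data.Empty using (⊥; ⊥-elim)
open import Data.Unit using (⊤)
open import Data.Maybe using (Maybe; just; nothing; maybe)
open import Data.Product using (Σ; _×_; _,_)
open import Data.Sum using (_⊎_)
open import Data.Vec using (Vec; []; _∷_; map)
open import Data.Vec.Relation.Unary.Any using (Any)
open import Data.Vec.Relation.Binary.Pointwise.Inductive using (Pointwise)
open import Data.List using (List)
open import Data.List.Membership.Propositional using (_∈_)
open import Relation.Nullary using (¬_)
open import Relation.Binary.PropositionalEquality using (_≡_)
open import Relation.Binary.Construct.Closure.ReflexiveTransitive using (Star)
open import Function.Bundles using (_↔_)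

-- Ranked alphabet: Sym m = symbols of rank m.  Finiteness of Σ.

FiniteAlphabet : (ℕ → Set) → Set
FiniteAlphabet Sym =
  Σ ℕ λ N → (∀ m → N < m → ¬ Sym m) × (∀ m → Σ ℕ λ k → Sym m ↔ Fin k)

-- Terms over Σ with leaves ("variables") from V.
-- Ground terms: Tm Sym ⊥.  T_Σ(X_m): Tm Sym (Fin m).
-- Terms over Σ ∪ A (A = states): Tm Sym (Ground Sym).

data Tm (Sym : ℕ → Set) (V : Set) : Set where
  var  : V → Tm Sym V
  node : ∀ {m} → Sym m → Vec (Tm Sym V) m → Tm Sym V

Ground : (ℕ → Set) → Set
Ground Sym = Tm Sym ⊥

module _ {Sym : ℕ → Set} where

  mutual
    subst : ∀ {A B : Set} → Tm Sym A → (A → Tm Sym B) → Tm Sym B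
    subst (var x)     σ = σ x
    subst (node f ts) σ = node f (substs ts σ)

    substs : ∀ {A B : Set} {m} → Vec (Tm Sym A) m → (A → Tm Sym B) → Vec (Tm Sym B) m
    substs []       σ = []
    substs (t ∷ ts) σ = subst t σ ∷ substs ts σ

  _⟦_⟧ : ∀ {V : Set} {m} → Tm Sym (Fin m) → (Fin m → Tm Sym V) → Tm Sym V
  t ⟦ us ⟧ = subst t us

  data Occurs {V : Set} (x : V) : Tm Sym V → Set where
    here  : Occurs x (var x)
    there : ∀ {m} {f : Sym m} {ts} → Any (Occurs x) ts → Occurs x (node f ts)

  data _⊑_ {V : Set} (s : Tm Sym V) : Tm Sym V → Set where
    refl⊑ : s ⊑ s
    child : ∀ {m} {f : Sym m} {ts} → Any (s ⊑_) ts → s ⊑ node f ts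

  -- number of occurrences of the hole x₁ (leaf 'nothing')
  mutual
    holes : ∀ {V : Set} → Tm Sym (Maybe V) → ℕ
    holes (var nothing)  = 1
    holes (var (just _)) = 0
    holes (node f ts)    = holesV ts

    holesV : ∀ {V : Set} {m} → Vec (Tm Sym (Maybe V)) m → ℕ
    holesV []       = 0
    holesV (t ∷ ts) = holes t Data.Nat.+ holesV ts

  Ctx : Set → Set
  Ctx V = Σ (Tm Sym (Maybe V)) λ u → holes u ≡ 1

  plug : ∀ {V : Set} → Ctx V → Tm Sym V → Tm Sym V
  plug (u , _) s = subst u (maybe var s)

  record Equation : Set where
    constructor _≈_∶_
    field
      arity : ℕ
      lhs   : Tm Sym (Fin arity)
      rhs   : Tm Sym (Fin arity)

  TES : Set
  TES = List Equation

  VarPreserving : Equation → Set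
  VarPreserving e = ∀ j → (Occurs j lhs → Occurs j rhs) × (Occurs j rhs → Occurs j lhs)
    where open Equation e

  StepS : TES → Ground Sym → Ground Sym → Set
  StepS S s t = Σ Equation λ e → e ∈ S × Σ (Ctx ⊥) λ u →
    Σ (Fin (Equation.arity e) → Ground Sym) λ us →
      (s ≡ plug u (Equation.lhs e ⟦ us ⟧) × t ≡ plug u (Equation.rhs e ⟦ us ⟧))
    ⊎ (s ≡ plug u (Equation.rhs e ⟦ us ⟧) × t ≡ plug u (Equation.lhs e ⟦ us ⟧))

  -- GTES, given as the (finite) predicate of its equations l ≈ r
  GTES : Set₁
  GTES = Ground Sym → Ground Sym → Set

  GStep : GTES → Ground Sym → Ground Sym → Set
  GStep E s t = Σ (Ground Sym) λ l → Σ (Ground Sym) λ r → E l r × Σ (Ctx ⊥) λ u →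
    (s ≡ plug u l × t ≡ plug u r) ⊎ (s ≡ plug u r × t ≡ plug u l)

  GStar : GTES → Ground Sym → Ground Sym → Set
  GStar E = Star (GStep E)

  -- congruence class computing tree automaton associated with E and p, q.
  -- A state [t]_Θ is represented by a term t ∈ T; two representatives
  -- denote the same state iff they are Θ-related.

  module Automaton (E : GTES) (p q : Ground Sym) where

    InT : Ground Sym → Set
    InT t = t ⊑ p ⊎ t ⊑ q ⊎
            (Σ (Ground Sym) λ l → Σ (Ground Sym) λ r → E l r × (t ⊑ l ⊎ t ⊑ r))

    Θ : Ground Sym → Ground Sym → Set
    Θ s t = InT s × InT t × GStar E s t

    Mixed : Set
    Mixed = Tm Sym (Ground Sym)

    -- rules f([t₁],…,[tₘ]) → [f(t₁,…,tₘ)] for f(t₁,…,tₘ) ∈ T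
    Rule : Mixed → Mixed → Set
    Rule lft rgt = Σ ℕ λ m → Σ (Sym m) λ f → Σ (Vec (Ground Sym) m) λ ts →
      InT (node f ts) × Σ (Vec (Ground Sym) m) λ as →
      Pointwise Θ as ts × lft ≡ node f (map var as) × rgt ≡ var (node f ts)

    RStep : Mixed → Mixed → Set
    RStep M M' = Σ (Ctx (Ground Sym)) λ u → Σ Mixed λ lft → Σ Mixed λ rgt →
      Rule lft rgt × M ≡ plug u lft × M' ≡ plug u rgt

    Reaches : Mixed → Ground Sym → Set
    Reaches M a = Σ (Ground Sym) λ s → Star RStep M (var s) × Θ s a

    ReachesFrom : Ground Sym → Ground Sym → Set
    ReachesFrom c b = Σ (Ctx (Ground Sym)) λ u → Reaches (plug u (var c)) b

    embed : Ground Sym → Mixed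
    embed g = subst g (λ ())

    ValidTree : (Ground Sym → Ground Sym) → Set
    ValidTree tree = (∀ t → InT t → Reaches (embed (tree t)) t)
                   × (∀ s t → Θ s t → tree s ≡ tree t)

  -- the sequence W₁, W₂, …   (W S p q tr k  is  W_{k+1})
  -- tr k is the fixed tree function of the automaton of W_{k+1}.

  module _ (S : TES) (p q : Ground Sym) where

    SubPQ : Ground Sym → Set
    SubPQ t = t ⊑ p ⊎ t ⊑ q

    W₁ : GTES
    W₁ l' r' = Σ Equation λ e → e ∈ S × Σ (Fin (Equation.arity e) → Ground Sym) λ us →
      l' ≡ Equation.lhs e ⟦ us ⟧ × r' ≡ Equation.rhs e ⟦ us ⟧ ×
      (SubPQ (Equation.lhs e ⟦ us ⟧) ⊎ SubPQ (Equation.rhs e ⟦ us ⟧))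

    NewEqs : GTES → (Ground Sym → Ground Sym) → GTES
    NewEqs Wi tree l' r' = Σ Equation λ e → e ∈ S ×
      Σ (Fin (Equation.arity e) → Ground Sym) λ as → Σ (Ground Sym) λ a →
        (∀ j → InT (as j)) × InT a ×
        (Reaches (Equation.lhs e ⟦ (λ j → var (as j)) ⟧) a
          ⊎ Reaches (Equation.rhs e ⟦ (λ j → var (as j)) ⟧) a) ×
        (ReachesFrom a p ⊎ ReachesFrom a q) ×
        ¬ GStar Wi (Equation.lhs e ⟦ (λ j → tree (as j)) ⟧)
                   (Equation.rhs e ⟦ (λ j → tree (as j)) ⟧) ×
        l' ≡ Equation.lhs e ⟦ (λ j → tree (as j)) ⟧ ×
        r' ≡ Equation.rhs e ⟦ (λ j → tree (as j)) ⟧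
      where open Automaton Wi p q

    W : (ℕ → Ground Sym → Ground Sym) → ℕ → GTES
    W tr zero    = W₁
    W tr (suc k) = λ l' r' → W tr k l' r' ⊎ NewEqs (W tr k) (tr k) l' r'

  Chain : (Ground Sym → Ground Sym → Set) → Ground Sym → ∀ {n} → Vec (Ground Sym) n → Set
  Chain R x []       = ⊤
  Chain R x (t ∷ ts) = R x t × Chain R t ts

module Submission where

-- By induction along the chain: the first step rewrites a
-- subterm of p or q, so it is a W₁-step; and if the current term x is W_{d+1}-
-- equivalent to p, an S-step x = u[lσ] → u[rσ] is a W_{d+2}-equivalence.  For the
-- latter, the run of the automaton of W_{d+1} on x (it exists since x ⇔* p) passes
-- through a state a of lσ, from which [p] is reachable, and through states aⱼ of the
-- σ(j), with σ(j) ⇔* tree(aⱼ); so u[lσ] ⇔* u[l[tree(aⱼ)]] and u[r[tree(aⱼ)]] ⇔* u[rσ]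
-- (variable preservation), while l[tree(aⱼ)] ≈ r[tree(aⱼ)] is either already valid
-- in W_{d+1} or one of the equations added to form W_{d+2}.
-- This case split needs ⇔*_{W_i} to be decidable: we list each W_i explicitly
-- (the alphabet is finite), decide everything about its automaton from that list,
-- and decide ⇔* by comparing states.

open import Defs

open import Data.Empty using (⊥; ⊥-elim)
open import Data.Unit using (tt)
open import Data.Bool using (Bool; true; false)
open import Data.Nat using (ℕ; zero; suc; _+_; _≤_; _<_; _≤′_; ≤′-refl; ≤′-step; z≤n; s≤s)
open import Data.Nat.Properties
  using (m+n≡0⇒m≡0; m+n≡0⇒n≡0; +-identityʳ; suc-injective; ≤-trans; ≤-refl; m≤n⇒m≤1+n; <⇒≱;
         ≤⇒≤′; +-suc; m+n≤o⇒m≤o)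
open import Data.Fin using (Fin; zero; suc)
open import Data.Fin.Properties using (all?)
open import Data.Maybe using (Maybe; just; nothing; maybe; fromMaybe)
open import Data.Product using (Σ; _×_; _,_; proj₁; proj₂)
open import Data.Sum using (_⊎_; inj₁; inj₂)
open import Data.Vec using (Vec; []; _∷_; map; lookup; tabulate; _[_]≔_)
open import Data.Vec.Properties using (lookup∘tabulate)
open import Data.Vec.Relation.Unary.Any using (here; there; index)
  renaming (Any to VAny; any? to vany?; map to VAny-map)
open import Data.Vec.Relation.Unary.Any.Properties using (lookup-index)
open import Data.Vec.Relation.Binary.Pointwise.Inductive using (Pointwise; []; _∷_)
  renaming (map to pointwise-map; trans to pointwise-trans; decidable to pointwise?)
open import Data.List using (List; []; _∷_; _++_; length; concatMap; filter; cartesianProduct)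
  renaming (map to mapᴸ)
open import Data.List.Relation.Unary.Any using (Any; any?)
  renaming (here to hereₗ; there to thereₗ; map to Any-map)
open import Data.List.Relation.Unary.All using (All) renaming (lookup to lookupₐ)
open import Data.List.Membership.Propositional using (_∈_; find; lose)
open import Data.List.Membership.Propositional.Properties
  using (∈-++⁺ˡ; ∈-++⁺ʳ; ∈-++⁻; ∈-map⁺; ∈-map⁻; ∈-concatMap⁺; ∈-concatMap⁻; ∈-filter⁺; ∈-filter⁻;
         ∈-cartesianProduct⁺; ∈-cartesianProduct⁻)
import Data.List.Membership.DecPropositional as DecMembership
open import Relation.Nullary using (¬_; Dec; yes; no)
open import Relation.Nullary.Decidable using (_×-dec_; _⊎-dec_; ¬?; map′; via-injection)
open import Relation.Unary using (Decidable)
open import Relation.Binary.PropositionalEquality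
  using (_≡_; refl; sym; trans; cong; cong₂; subst₂) renaming (subst to ≡-subst)
open import Relation.Binary.Construct.Closure.ReflexiveTransitive using (Star; ε; _◅_; _◅◅_; reverse)
  renaming (map to star-map)
open import Function.Properties.Inverse using (↔⇒↣)

module _ {A : Set} where

  any-≔ : ∀ {P : A → Set} {n} (xs : Vec A n) i {y} → P y → VAny P (xs [ i ]≔ y)
  any-≔ (x ∷ xs) zero    py = here py
  any-≔ (x ∷ xs) (suc i) py = there (any-≔ xs i py)

  any-lookup : ∀ {P : A → Set} {n} (xs : Vec A n) i → P (lookup xs i) → VAny P xs
  any-lookup (x ∷ xs) zero    px = here px
  any-lookup (x ∷ xs) (suc i) px = there (any-lookup xs i px)

  module _ {B : Set} {R : A → B → Set} where

    ≔-pointwise⁻ : ∀ {n} (xs : Vec A n) i {x} {bs : Vec B n} → Pointwise R (xs [ i ]≔ x) bs →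
      R x (lookup bs i) × (∀ {y} → R y (lookup bs i) → Pointwise R (xs [ i ]≔ y) bs)
    ≔-pointwise⁻ (x ∷ xs) zero    (r ∷ rs) = r , λ r' → r' ∷ rs
    ≔-pointwise⁻ (x ∷ xs) (suc i) (r ∷ rs) =
      proj₁ (≔-pointwise⁻ xs i rs) , λ r' → r ∷ proj₂ (≔-pointwise⁻ xs i rs) r'

    ≔-pointwise⁺ : ∀ {n} {xs : Vec A n} {bs : Vec B n} → Pointwise R xs bs →
      ∀ i {y} → R y (lookup bs i) → Pointwise R (xs [ i ]≔ y) bs
    ≔-pointwise⁺ (r ∷ rs) zero    r' = r' ∷ rs
    ≔-pointwise⁺ (r ∷ rs) (suc i) r' = r ∷ ≔-pointwise⁺ rs i r'

-- Counting the elements of a list satisfying a decidable predicate.  Used to bound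
-- the number of rounds before a growing family of subsets of a list stabilises.
module _ {A : Set} where

  count : {P : A → Set} → Decidable P → List A → ℕ
  count P? []       = 0
  count P? (x ∷ xs) with P? x
  ... | yes _ = suc (count P? xs)
  ... | no _  = count P? xs

  count≤length : {P : A → Set} (P? : Decidable P) → ∀ xs → count P? xs ≤ length xs
  count≤length P? []       = z≤n
  count≤length P? (x ∷ xs) with P? x
  ... | yes _ = s≤s (count≤length P? xs)
  ... | no _  = m≤n⇒m≤1+n (count≤length P? xs)

  module _ {P Q : A → Set} (P? : Decidable P) (Q? : Decidable Q) (P⊆Q : ∀ {x} → P x → Q x) where

    count-mono : ∀ xs → count P? xs ≤ count Q? xs
    count-mono []       = z≤n
    count-mono (x ∷ xs) with P? x | Q? x
    ... | yes _  | yes _  = s≤s (count-mono xs)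
    ... | yes px | no ¬qx = ⊥-elim (¬qx (P⊆Q px))
    ... | no _   | yes _  = m≤n⇒m≤1+n (count-mono xs)
    ... | no _   | no _   = count-mono xs

    count-strict : ∀ xs → Any (λ x → Q x × ¬ P x) xs → count P? xs < count Q? xs
    count-strict (x ∷ xs) new with P? x | Q? x | new
    ... | yes px | _      | hereₗ (_ , ¬px) = ⊥-elim (¬px px)
    ... | yes _  | yes _  | thereₗ new'     = s≤s (count-strict xs new')
    ... | yes px | no ¬qx | _               = ⊥-elim (¬qx (P⊆Q px))
    ... | no _   | yes _  | _               = s≤s (count-mono xs)
    ... | no _   | no ¬qx | hereₗ (qx , _)  = ⊥-elim (¬qx qx)
    ... | no _   | no _   | thereₗ new'     = count-strict xs new'

module _ {A : Set} where

  vectors : List A → (m : ℕ) → List (Vec A m)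
  vectors xs zero    = [] ∷ []
  vectors xs (suc m) = concatMap (λ x → mapᴸ (x ∷_) (vectors xs m)) xs

  ∈-vectors : ∀ {xs : List A} {m} (v : Vec A m) → (∀ j → lookup v j ∈ xs) → v ∈ vectors xs m
  ∈-vectors []                      h = hereₗ refl
  ∈-vectors {xs = xs} {suc m} (x ∷ v) h =
    ∈-concatMap⁺ (λ x → mapᴸ (x ∷_) (vectors xs m)) (lose (h zero) (∈-map⁺ (x ∷_) (∈-vectors v (λ j → h (suc j)))))

module _ {Sym : ℕ → Set} where

  private
    Term = Tm Sym
    G = Ground Sym

  mutual
    subst-cong : ∀ {A B : Set} (t : Term A) {σ τ : A → Term B} →
      (∀ x → Occurs x t → σ x ≡ τ x) → subst t σ ≡ subst t τ
    subst-cong (var x)     eq = eq x here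
    subst-cong (node f ts) eq = cong (node f) (substs-cong ts λ x o → eq x (there o))

    substs-cong : ∀ {A B : Set} {m} (ts : Vec (Term A) m) {σ τ : A → Term B} →
      (∀ x → VAny (Occurs x) ts → σ x ≡ τ x) → substs ts σ ≡ substs ts τ
    substs-cong []       eq = refl
    substs-cong (t ∷ ts) eq =
      cong₂ _∷_ (subst-cong t λ x o → eq x (here o)) (substs-cong ts λ x o → eq x (there o))

  mutual
    subst-subst : ∀ {A B C : Set} (t : Term A) (σ : A → Term B) (τ : B → Term C) →
      subst (subst t σ) τ ≡ subst t (λ x → subst (σ x) τ)
    subst-subst (var x)     σ τ = refl
    subst-subst (node f ts) σ τ = cong (node f) (substs-subst ts σ τ)

    substs-subst : ∀ {A B C : Set} {m} (ts : Vec (Term A) m) (σ : A → Term B) (τ : B → Term C) →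
      substs (substs ts σ) τ ≡ substs ts (λ x → subst (σ x) τ)
    substs-subst []       σ τ = refl
    substs-subst (t ∷ ts) σ τ = cong₂ _∷_ (subst-subst t σ τ) (substs-subst ts σ τ)

  mutual
    subst-var : ∀ {A : Set} (t : Term A) {σ : A → Term A} → (∀ x → σ x ≡ var x) → subst t σ ≡ t
    subst-var (var x)     eq = eq x
    subst-var (node f ts) eq = cong (node f) (substs-var ts eq)

    substs-var : ∀ {A : Set} {m} (ts : Vec (Term A) m) {σ : A → Term A} →
      (∀ x → σ x ≡ var x) → substs ts σ ≡ ts
    substs-var []       eq = refl
    substs-var (t ∷ ts) eq = cong₂ _∷_ (subst-var t eq) (substs-var ts eq)

  substs-≔ : ∀ {A B : Set} {m} (xs : Vec (Term A) m) i y (σ : A → Term B) →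
    substs (xs [ i ]≔ y) σ ≡ substs xs σ [ i ]≔ subst y σ
  substs-≔ (x ∷ xs) zero    y σ = refl
  substs-≔ (x ∷ xs) (suc i) y σ = cong (subst x σ ∷_) (substs-≔ xs i y σ)

  -- One-hole contexts as paths from the root to the hole.  Defs' 'Ctx' counts
  -- holes instead; 'toCtx' and 'fromCtx' below translate between the two.
  data Context (V : Set) : Set where
    hole : Context V
    down : ∀ {m} (f : Sym m) (i : Fin m) (xs : Vec (Term V) m) → Context V → Context V

  fill : ∀ {V} → Context V → Term V → Term V
  fill hole           s = s
  fill (down f i xs c) s = node f (xs [ i ]≔ fill c s)

  _∘ᶜ_ : ∀ {V} → Context V → Context V → Context V
  hole           ∘ᶜ d = d
  down f i xs c ∘ᶜ d = down f i xs (c ∘ᶜ d)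

  fill-∘ᶜ : ∀ {V} (c d : Context V) s → fill (c ∘ᶜ d) s ≡ fill c (fill d s)
  fill-∘ᶜ hole           d s = refl
  fill-∘ᶜ (down f i xs c) d s = cong (λ z → node f (xs [ i ]≔ z)) (fill-∘ᶜ c d s)

  substᶜ : ∀ {A B} → Context A → (A → Term B) → Context B
  substᶜ hole           σ = hole
  substᶜ (down f i xs c) σ = down f i (substs xs σ) (substᶜ c σ)

  subst-fill : ∀ {A B} (c : Context A) s (σ : A → Term B) →
    subst (fill c s) σ ≡ fill (substᶜ c σ) (subst s σ)
  subst-fill hole           s σ = refl
  subst-fill (down f i xs c) s σ =
    cong (node f) (trans (substs-≔ xs i (fill c s) σ) (cong (substs xs σ [ i ]≔_) (subst-fill c s σ)))

  ⊑-fill : ∀ {V} (c : Context V) s → s ⊑ fill c s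
  ⊑-fill hole           s = refl⊑
  ⊑-fill (down f i xs c) s = child (any-≔ xs i (⊑-fill c s))

  private
    weaken : ∀ {V} → Term V → Term (Maybe V)
    weaken t = subst t (λ x → var (just x))

    weakens : ∀ {V m} → Vec (Term V) m → Vec (Term (Maybe V)) m
    weakens ts = substs ts (λ x → var (just x))

  mutual
    holes-weaken : ∀ {V} (t : Term V) → holes (weaken t) ≡ 0
    holes-weaken (var x)     = refl
    holes-weaken (node f ts) = holesV-weaken ts

    holesV-weaken : ∀ {V m} (ts : Vec (Term V) m) → holesV (weakens ts) ≡ 0
    holesV-weaken []       = refl
    holesV-weaken (t ∷ ts) = cong₂ _+_ (holes-weaken t) (holesV-weaken ts)

  holesV-≔ : ∀ {V m} (xs : Vec (Term V) m) i u → holesV (weakens xs [ i ]≔ u) ≡ holes u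
  holesV-≔ (x ∷ xs) zero    u = trans (cong (holes u +_) (holesV-weaken xs)) (+-identityʳ _)
  holesV-≔ (x ∷ xs) (suc i) u = trans (cong (_+ _) (holes-weaken x)) (holesV-≔ xs i u)

  toTm : ∀ {V} → Context V → Term (Maybe V)
  toTm hole           = var nothing
  toTm (down f i xs c) = node f (weakens xs [ i ]≔ toTm c)

  holes-toTm : ∀ {V} (c : Context V) → holes (toTm c) ≡ 1
  holes-toTm hole           = refl
  holes-toTm (down f i xs c) = trans (holesV-≔ xs i (toTm c)) (holes-toTm c)

  toCtx : ∀ {V} → Context V → Ctx V
  toCtx c = toTm c , holes-toTm c

  plug-toCtx : ∀ {V} (c : Context V) s → plug (toCtx c) s ≡ fill c s
  plug-toCtx hole           s = refl
  plug-toCtx (down f i xs c) s = cong (node f) (trans (substs-≔ (weakens xs) i (toTm c) _)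
    (cong₂ (_[ i ]≔_) (trans (substs-subst xs _ _) (substs-var xs λ _ → refl)) (plug-toCtx c s)))

  -- From Defs contexts to paths.  A subterm without holes is unaffected by
  -- plugging; 'w' is an arbitrary term used to fill the hole-free siblings.
  mutual
    plug-closed : ∀ {V} (u : Term (Maybe V)) → holes u ≡ 0 →
      ∀ s s' → subst u (maybe var s) ≡ subst u (maybe var s')
    plug-closed (var nothing)  ()
    plug-closed (var (just x)) h s s' = refl
    plug-closed (node f us)    h s s' = cong (node f) (plugs-closed us h s s')

    plugs-closed : ∀ {V m} (us : Vec (Term (Maybe V)) m) → holesV us ≡ 0 →
      ∀ s s' → substs us (maybe var s) ≡ substs us (maybe var s')
    plugs-closed []       h s s' = refl
    plugs-closed (u ∷ us) h s s' = cong₂ _∷_ (plug-closed u (m+n≡0⇒m≡0 (holes u) h) s s')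
                                            (plugs-closed us (m+n≡0⇒n≡0 (holes u) h) s s')

  mutual
    fromTm : ∀ {V} (w : Term V) (u : Term (Maybe V)) → holes u ≡ 1 →
      Σ (Context V) λ c → ∀ s → subst u (maybe var s) ≡ fill c s
    fromTm w (var nothing)  h = hole , λ s → refl
    fromTm w (var (just x)) ()
    fromTm w (node f us)    h with fromTms w us h
    ... | xs , i , c , eq = down f i xs c , λ s → cong (node f) (eq s)

    fromTms : ∀ {V m} (w : Term V) (us : Vec (Term (Maybe V)) m) → holesV us ≡ 1 →
      Σ (Vec (Term V) m) λ xs → Σ (Fin m) λ i → Σ (Context V) λ c →
        ∀ s → substs us (maybe var s) ≡ xs [ i ]≔ fill c s
    fromTms w [] ()
    fromTms w (u ∷ us) h with holes u in eq
    ... | zero with fromTms w us h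
    ...   | xs , i , c , eq' = subst u (maybe var w) ∷ xs , suc i , c ,
                               λ s → cong₂ _∷_ (plug-closed u eq s w) (eq' s)
    fromTms w (u ∷ us) h | suc zero with fromTm w u eq
    ...   | c , eq' = w ∷ substs us (maybe var w) , zero , c ,
                      λ s → cong₂ _∷_ (eq' s) (plugs-closed us (suc-injective h) s w)
    fromTms w (u ∷ us) () | suc (suc _)

  fromCtx : ∀ {V} (w : Term V) (u : Ctx V) → Σ (Context V) λ c → ∀ s → plug u s ≡ fill c s
  fromCtx w (u , h) = fromTm w u h

  ⊑-plug : (u : Ctx ⊥) (s : G) → s ⊑ plug u s
  ⊑-plug u s with fromCtx s u
  ... | c , eq = ≡-subst (s ⊑_) (sym (eq s)) (⊑-fill c s)

  mutual
    occurs? : ∀ {m} (j : Fin m) (l : Term (Fin m)) → Dec (Occurs j l)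
    occurs? j (var i) with i Data.Fin.≟ j
    ... | yes refl = yes here
    ... | no i≢j   = no λ { here → i≢j refl }
    occurs? j (node f ls) with occurs-any? j ls
    ... | yes o = yes (there o)
    ... | no ¬o = no λ { (there o) → ¬o o }

    occurs-any? : ∀ {m k} (j : Fin m) (ls : Vec (Term (Fin m)) k) → Dec (VAny (Occurs j) ls)
    occurs-any? j []       = no λ ()
    occurs-any? j (l ∷ ls) with occurs? j l | occurs-any? j ls
    ... | yes o | _     = yes (here o)
    ... | no _  | yes o = yes (there o)
    ... | no ¬o | no ¬os = no λ { (here o) → ¬o o ; (there o) → ¬os o }

  mutual
    ⊑-trans : ∀ {V} {s t u : Term V} → s ⊑ t → t ⊑ u → s ⊑ u
    ⊑-trans s⊑t refl⊑        = s⊑t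
    ⊑-trans s⊑t (child t⊑us) = child (⊑-trans-any s⊑t t⊑us)

    ⊑-trans-any : ∀ {V m} {s t : Term V} {us : Vec (Term V) m} →
      s ⊑ t → VAny (t ⊑_) us → VAny (s ⊑_) us
    ⊑-trans-any s⊑t (here t⊑u)   = here (⊑-trans s⊑t t⊑u)
    ⊑-trans-any s⊑t (there t⊑us) = there (⊑-trans-any s⊑t t⊑us)

  mutual
    subterms : G → List G
    subterms (node f ts) = node f ts ∷ subtermsV ts

    subtermsV : ∀ {m} → Vec G m → List G
    subtermsV []       = []
    subtermsV (t ∷ ts) = subterms t ++ subtermsV ts

  mutual
    ∈-subterms⁺ : ∀ {t s : G} → t ⊑ s → t ∈ subterms s
    ∈-subterms⁺ {s = node f ts} refl⊑         = hereₗ refl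
    ∈-subterms⁺ {s = node f ts} (child t⊑ts) = thereₗ (∈-subtermsV⁺ t⊑ts)

    ∈-subtermsV⁺ : ∀ {m} {t : G} {ts : Vec G m} → VAny (t ⊑_) ts → t ∈ subtermsV ts
    ∈-subtermsV⁺ (here t⊑s)                = ∈-++⁺ˡ (∈-subterms⁺ t⊑s)
    ∈-subtermsV⁺ {ts = s ∷ ts} (there t⊑ts) = ∈-++⁺ʳ (subterms s) (∈-subtermsV⁺ t⊑ts)

  mutual
    ∈-subterms⁻ : ∀ {t : G} s → t ∈ subterms s → t ⊑ s
    ∈-subterms⁻ (node f ts) (hereₗ refl) = refl⊑
    ∈-subterms⁻ (node f ts) (thereₗ t∈) = child (∈-subtermsV⁻ ts t∈)

    ∈-subtermsV⁻ : ∀ {m} {t : G} (ts : Vec G m) → t ∈ subtermsV ts → VAny (t ⊑_) ts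
    ∈-subtermsV⁻ (s ∷ ts) t∈ with ∈-++⁻ (subterms s) t∈
    ... | inj₁ t∈s  = here (∈-subterms⁻ s t∈s)
    ... | inj₂ t∈ts = there (∈-subtermsV⁻ ts t∈ts)

  module DecidableEquality (finite : FiniteAlphabet Sym) where

    _≟ₛ_ : ∀ {m} (f g : Sym m) → Dec (f ≡ g)
    _≟ₛ_ {m} = via-injection (↔⇒↣ (proj₂ (proj₂ (proj₂ finite) m))) Data.Fin._≟_

    mutual
      _≟_ : (s t : G) → Dec (s ≡ t)
      node {m} f ts ≟ node {m'} g ss with m Data.Nat.≟ m'
      ... | no m≢m' = no λ { refl → m≢m' refl }
      ... | yes refl with f ≟ₛ g | ts ≟ⱽ ss
      ...   | yes refl | yes refl = yes refl
      ...   | no f≢g   | _        = no λ { refl → f≢g refl }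
      ...   | yes _    | no ts≢ss = no λ { refl → ts≢ss refl }

      _≟ⱽ_ : ∀ {m} (ts ss : Vec G m) → Dec (ts ≡ ss)
      []       ≟ⱽ []       = yes refl
      (t ∷ ts) ≟ⱽ (s ∷ ss) with t ≟ s | ts ≟ⱽ ss
      ... | yes refl | yes refl = yes refl
      ... | no t≢s   | _        = no λ { refl → t≢s refl }
      ... | yes _    | no ts≢ss = no λ { refl → ts≢ss refl }

  module Congruence {V : Set} (R : Term V → Term V → Set)
                    (R-fill : ∀ (c : Context V) {x y} → R x y → R (fill c x) (fill c y)) where

    star-fill : ∀ (c : Context V) {x y} → Star R x y → Star R (fill c x) (fill c y)
    star-fill c ε        = ε
    star-fill c (r ◅ rs) = R-fill c r ◅ star-fill c rs

    args-cong : ∀ {n} (build : Vec (Term V) n → Term V) →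
      (∀ i v → Σ (Context V) λ c → ∀ s → fill c s ≡ build (v [ i ]≔ s)) →
      ∀ {ss ts} → Pointwise (Star R) ss ts → Star R (build ss) (build ts)
    args-cong build position [] = ε
    args-cong build position {s ∷ ss} {t ∷ ts} (r ∷ rs) =
      first ◅◅ args-cong (λ v → build (t ∷ v)) (λ i v → position (suc i) (t ∷ v)) rs
      where
        first : Star R (build (s ∷ ss)) (build (t ∷ ss))
        first with position zero (s ∷ ss)
        ... | c , eq = subst₂ (Star R) (eq s) (eq t) (star-fill c r)

    node-cong : ∀ {m} (f : Sym m) {ss ts} → Pointwise (Star R) ss ts → Star R (node f ss) (node f ts)
    node-cong f = args-cong (node f) (λ i v → down f i v hole , λ s → refl)

    mutual
      subst-star : ∀ {A : Set} (l : Term A) {σ τ : A → Term V} →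
        (∀ x → Occurs x l → Star R (σ x) (τ x)) → Star R (subst l σ) (subst l τ)
      subst-star (var x)     h = h x here
      subst-star (node f ls) h = node-cong f (substs-star ls λ x o → h x (there o))

      substs-star : ∀ {A : Set} {m} (ls : Vec (Term A) m) {σ τ : A → Term V} →
        (∀ x → VAny (Occurs x) ls → Star R (σ x) (τ x)) → Pointwise (Star R) (substs ls σ) (substs ls τ)
      substs-star []       h = []
      substs-star (l ∷ ls) h = subst-star l (λ x o → h x (here o)) ∷ substs-star ls λ x o → h x (there o)

  -- A Defs context placed inside a path context is again a Defs context
  -- ('w' is any term of the right sort, needed to read off the path).
  nest : ∀ {V} (c : Context V) (u : Ctx V) (w : Term V) →
    Σ (Ctx V) λ u' → ∀ s → plug u' s ≡ fill c (plug u s)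
  nest c u w with fromCtx w u
  ... | d , eq = toCtx (c ∘ᶜ d) ,
                 λ s → trans (plug-toCtx (c ∘ᶜ d) s) (trans (fill-∘ᶜ c d s) (cong (fill c) (sym (eq s))))

  module Rewriting (E : GTES {Sym}) where

    ⇔-sym : ∀ {s t} → GStep E s t → GStep E t s
    ⇔-sym (l , r , e , u , inj₁ (s≡ , t≡)) = l , r , e , u , inj₂ (t≡ , s≡)
    ⇔-sym (l , r , e , u , inj₂ (s≡ , t≡)) = l , r , e , u , inj₁ (t≡ , s≡)

    ⇔*-sym : ∀ {s t} → GStar E s t → GStar E t s
    ⇔*-sym = reverse ⇔-sym

    ⇔-axiom : ∀ {l r} → E l r → GStep E l r
    ⇔-axiom e = _ , _ , e , (var nothing , refl) , inj₁ (refl , refl)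

    ⇔-fill : ∀ (c : Context ⊥) {x y} → GStep E x y → GStep E (fill c x) (fill c y)
    ⇔-fill c (l , r , e , u , side) with nest c u l
    ... | u' , eq = l , r , e , u' , lift side
      where
        lift : ∀ {x y} → (x ≡ plug u l × y ≡ plug u r) ⊎ (x ≡ plug u r × y ≡ plug u l) →
          (fill c x ≡ plug u' l × fill c y ≡ plug u' r) ⊎ (fill c x ≡ plug u' r × fill c y ≡ plug u' l)
        lift (inj₁ (refl , refl)) = inj₁ (sym (eq l) , sym (eq r))
        lift (inj₂ (refl , refl)) = inj₂ (sym (eq r) , sym (eq l))

    open Congruence (GStep E) ⇔-fill public
      using () renaming (node-cong to ⇔*-node; subst-star to ⇔*-subst; star-fill to ⇔*-fill)

    ⇔*-plug : ∀ (u : Ctx ⊥) {x y} → GStar E x y → GStar E (plug u x) (plug u y)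
    ⇔*-plug u {x} {y} x⇔*y with fromCtx x u
    ... | c , eq = subst₂ (GStar E) (sym (eq x)) (sym (eq y)) (⇔*-fill c x⇔*y)

  ⇔*-mono : ∀ {E E' : GTES {Sym}} → (∀ {l r} → E l r → E' l r) → ∀ {x y} → GStar E x y → GStar E' x y
  ⇔*-mono E⊆E' = star-map λ (l , r , e , u , side) → l , r , E⊆E' e , u , side

  -- Runs of the congruence class computing automaton of E and p, q.  'Run M c'
  -- is an inductive description of M →*_R [c]: every argument runs to a state,
  -- then the rule of the symbol applies.
  module Runs (E : GTES {Sym}) (p q : G) where
    open Automaton E p q public
    open Rewriting E public

    InT-⊑ : ∀ {s t} → s ⊑ t → InT t → InT s
    InT-⊑ s⊑t (inj₁ t⊑p)                          = inj₁ (⊑-trans s⊑t t⊑p)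
    InT-⊑ s⊑t (inj₂ (inj₁ t⊑q))                   = inj₂ (inj₁ (⊑-trans s⊑t t⊑q))
    InT-⊑ s⊑t (inj₂ (inj₂ (l , r , e , inj₁ t⊑l))) = inj₂ (inj₂ (l , r , e , inj₁ (⊑-trans s⊑t t⊑l)))
    InT-⊑ s⊑t (inj₂ (inj₂ (l , r , e , inj₂ t⊑r))) = inj₂ (inj₂ (l , r , e , inj₂ (⊑-trans s⊑t t⊑r)))

    InT-p : InT p
    InT-p = inj₁ refl⊑

    InT-q : InT q
    InT-q = inj₂ (inj₁ refl⊑)

    Θ-refl : ∀ {t} → InT t → Θ t t
    Θ-refl i = i , i , ε

    Θ-sym : ∀ {s t} → Θ s t → Θ t s
    Θ-sym (i , j , s⇔*t) = j , i , ⇔*-sym s⇔*t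

    Θ-trans : ∀ {s t u} → Θ s t → Θ t u → Θ s u
    Θ-trans (i , _ , s⇔*t) (_ , k , t⇔*u) = i , k , s⇔*t ◅◅ t⇔*u

    Θ-axiom : ∀ {l r} → E l r → Θ l r
    Θ-axiom {l} {r} e = inj₂ (inj₂ (l , r , e , inj₁ refl⊑)) , inj₂ (inj₂ (l , r , e , inj₂ refl⊑)) ,
                        ⇔-axiom e ◅ ε

    Θ-InTˡ : ∀ {s t} → Θ s t → InT s
    Θ-InTˡ = proj₁

    Θ-InTʳ : ∀ {s t} → Θ s t → InT t
    Θ-InTʳ θ = proj₁ (proj₂ θ)

    Θ-⇔* : ∀ {s t} → Θ s t → GStar E s t
    Θ-⇔* θ = proj₂ (proj₂ θ)

    data Run : Mixed → Ground Sym → Set where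
      run-var  : ∀ {a c} → Θ a c → Run (var a) c
      run-node : ∀ {m} {f : Sym m} {Ms : Vec Mixed m} {ts : Vec G m} {c} →
                 Pointwise Run Ms ts → InT (node f ts) → Θ (node f ts) c → Run (node f Ms) c

    run-InT : ∀ {M c} → Run M c → InT c
    run-InT (run-var θ)      = Θ-InTʳ θ
    run-InT (run-node _ _ θ) = Θ-InTʳ θ

    run-Θ : ∀ {M c c'} → Run M c → Θ c c' → Run M c'
    run-Θ (run-var θ)       θ' = run-var (Θ-trans θ θ')
    run-Θ (run-node rs i θ) θ' = run-node rs i (Θ-trans θ θ')

    mutual
      run-det : ∀ {M c c'} → Run M c → Run M c' → Θ c c'
      run-det (run-var θ)       (run-var θ')        = Θ-trans (Θ-sym θ) θ'
      run-det (run-node rs i θ) (run-node rs' i' θ') =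
        Θ-trans (Θ-sym θ) (Θ-trans (i , i' , ⇔*-node _ (pointwise-map Θ-⇔* (runs-det rs rs'))) θ')

      runs-det : ∀ {m} {Ms : Vec Mixed m} {as bs} → Pointwise Run Ms as → Pointwise Run Ms bs →
        Pointwise Θ as bs
      runs-det []       []         = []
      runs-det (r ∷ rs) (r' ∷ rs') = run-det r r' ∷ runs-det rs rs'

    mutual
      run-self : ∀ {t} → InT t → Run (embed t) t
      run-self {node f ts} i = run-node (runs-self ts (λ s⊑ts → InT-⊑ (child s⊑ts) i)) i (Θ-refl i)

      runs-self : ∀ {m} (ts : Vec G m) → (∀ {s} → VAny (s ⊑_) ts → InT s) →
        Pointwise Run (substs ts (λ ())) ts
      runs-self []       inT = []
      runs-self (t ∷ ts) inT = run-self (inT (here refl⊑)) ∷ runs-self ts (λ s⊑ts → inT (there s⊑ts))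

    run-fill : ∀ (c : Context G) X {d} → Run (fill c X) d →
      Σ G λ b → Run X b × (∀ {Y} → Run Y b → Run (fill c Y) d)
    run-fill hole             X r = _ , r , λ r' → r'
    run-fill (down f i xs c) X (run-node rs it θ) with ≔-pointwise⁻ xs i rs
    ... | r , rebuild with run-fill c X r
    ...   | b , rX , replace = b , rX , λ rY → run-node (rebuild (replace rY)) it θ

    flatten : Mixed → G
    flatten M = subst M (λ g → g)

    mutual
      run-sound : ∀ {M c} → Run M c → GStar E (flatten M) c
      run-sound (run-var θ)                = Θ-⇔* θ
      run-sound (run-node {f = f} rs _ θ) = ⇔*-node f (runs-sound rs) ◅◅ Θ-⇔* θ

      runs-sound : ∀ {m} {Ms : Vec Mixed m} {as} → Pointwise Run Ms as →
        Pointwise (GStar E) (substs Ms (λ g → g)) as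
      runs-sound []       = []
      runs-sound (r ∷ rs) = run-sound r ∷ runs-sound rs

    run-sound-embed : ∀ {g c} → Run (embed g) c → GStar E g c
    run-sound-embed {g} r =
      ≡-subst (λ x → GStar E x _) (trans (subst-subst g _ _) (subst-var g (λ ()))) (run-sound r)

    embedᶜ : Context ⊥ → Context G
    embedᶜ c = substᶜ c (λ ())

    embed-plug : ∀ (u : Ctx ⊥) w → Σ (Context ⊥) λ c → ∀ s → embed (plug u s) ≡ fill (embedᶜ c) (embed s)
    embed-plug u w with fromCtx w u
    ... | c , eq = c , λ s → trans (cong embed (eq s)) (subst-fill c s (λ ()))

    run-plug : ∀ (u : Ctx ⊥) {s s' c} → (∀ {b} → Run (embed s) b → Run (embed s') b) →
      Run (embed (plug u s)) c → Run (embed (plug u s')) c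
    run-plug u {s} {s'} s↝s' r with embed-plug u s
    ... | c , eq with run-fill (embedᶜ c) (embed s) (≡-subst (λ x → Run x _) (eq s) r)
    ...   | b , rs , replace = ≡-subst (λ x → Run x _) (sym (eq s')) (replace (s↝s' rs))

    run-Θ-terms : ∀ {l r b} → Θ l r → Run (embed l) b → Run (embed r) b
    run-Θ-terms θ rl = run-Θ (run-self (Θ-InTʳ θ)) (Θ-trans (Θ-sym θ) (run-det (run-self (Θ-InTˡ θ)) rl))

    run-⇔* : ∀ {x y c} → GStar E x y → Run (embed x) c → Run (embed y) c
    run-⇔* ε r = r
    run-⇔* ((l , r , e , u , inj₁ (refl , refl)) ◅ xs) run =
      run-⇔* xs (run-plug u (run-Θ-terms (Θ-axiom e)) run)
    run-⇔* ((l , r , e , u , inj₂ (refl , refl)) ◅ xs) run =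
      run-⇔* xs (run-plug u (run-Θ-terms (Θ-sym (Θ-axiom e))) run)

    rstep-fill : ∀ (c : Context G) {x y} → RStep x y → RStep (fill c x) (fill c y)
    rstep-fill c (u , lft , rgt , rule , refl , refl) with nest c u lft
    ... | u' , eq = u' , lft , rgt , rule , sym (eq lft) , sym (eq rgt)

    open Congruence RStep rstep-fill using () renaming (node-cong to rstep*-node)

    mutual
      run→reaches : ∀ {M c} → Run M c → Reaches M c
      run→reaches (run-var θ) = _ , ε , θ
      run→reaches (run-node {f = f} {ts = ts} rs it θ) with runs→reaches rs
      ... | ss , steps , θs = node f ts , rstep*-node f steps ◅◅ (apply ◅ ε) , θ
        where
          apply : RStep (node f (map var ss)) (var (node f ts))
          apply = (var nothing , refl) , _ , _ , (_ , f , ts , it , ss , θs , refl , refl) , refl , refl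

      runs→reaches : ∀ {m} {Ms : Vec Mixed m} {as} → Pointwise Run Ms as →
        Σ (Vec G m) λ ss → Pointwise (Star RStep) Ms (map var ss) × Pointwise Θ ss as
      runs→reaches []       = [] , [] , []
      runs→reaches (r ∷ rs) with run→reaches r | runs→reaches rs
      ... | s , st , θ | ss , sts , θs = s ∷ ss , st ∷ sts , θ ∷ θs

    run-vars : ∀ {m} {as ts : Vec G m} → Pointwise Θ as ts → Pointwise Run (map var as) ts
    run-vars []       = []
    run-vars (θ ∷ θs) = run-var θ ∷ run-vars θs

    run-backward : ∀ {M M' c} → RStep M M' → Run M' c → Run M c
    run-backward (u , _ , _ , (_ , f , ts , it , as , θs , refl , refl) , refl , refl) r
      with fromCtx (var (node f ts)) u
    ... | c , eq with run-fill c (var (node f ts)) (≡-subst (λ x → Run x _) (eq _) r)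
    ...   | b , run-var θ , replace = ≡-subst (λ x → Run x _) (sym (eq _)) (replace (run-node (run-vars θs) it θ))

    reaches→run : ∀ {M c} → Reaches M c → Run M c
    reaches→run (s , ε , θ)      = run-var θ
    reaches→run (s , x ◅ xs , θ) = run-backward x (reaches→run (s , xs , θ))

    reachesFrom : ∀ (c : Context G) {b d} → Run (fill c (var b)) d → ReachesFrom b d
    reachesFrom c {b} r = toCtx c , ≡-subst (λ x → Reaches x _) (sym (plug-toCtx c (var b))) (run→reaches r)

    mutual
      run-occurrence : ∀ {m} {j} {l : Term (Fin m)} {ρ : Fin m → Mixed} {c} →
        Occurs j l → Run (subst l ρ) c → Σ G λ b → Run (ρ j) b
      run-occurrence here      r                 = _ , r
      run-occurrence (there o) (run-node rs _ _) = runs-occurrence o rs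

      runs-occurrence : ∀ {m k} {j} {ls : Vec (Term (Fin m)) k} {ρ : Fin m → Mixed} {as} →
        VAny (Occurs j) ls → Pointwise Run (substs ls ρ) as → Σ G λ b → Run (ρ j) b
      runs-occurrence (here o)  (r ∷ rs) = run-occurrence o r
      runs-occurrence (there o) (r ∷ rs) = runs-occurrence o rs

    mutual
      run-abstract : ∀ {m} (l : Term (Fin m)) {ρ : Fin m → Mixed} {as : Fin m → G} {c} →
        Run (subst l ρ) c → (∀ j → Occurs j l → Run (ρ j) (as j)) → Run (l ⟦ (λ j → var (as j)) ⟧) c
      run-abstract (var j)     r                   h = run-var (run-det (h j here) r)
      run-abstract (node f ls) (run-node rs it θ) h = run-node (runs-abstract ls rs λ j o → h j (there o)) it θ

      runs-abstract : ∀ {m k} (ls : Vec (Term (Fin m)) k) {ρ : Fin m → Mixed} {as : Fin m → G} {bs} →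
        Pointwise Run (substs ls ρ) bs → (∀ j → VAny (Occurs j) ls → Run (ρ j) (as j)) →
        Pointwise Run (substs ls (λ j → var (as j))) bs
      runs-abstract []       []       h = []
      runs-abstract (l ∷ ls) (r ∷ rs) h =
        run-abstract l r (λ j o → h j (here o)) ∷ runs-abstract ls rs λ j o → h j (there o)

    -- Decomposing a run of an instance l[ρ] along l.  Variables not occurring in l
    -- get the state p.
    run-subst⁻ : ∀ {m} (l : Term (Fin m)) (ρ : Fin m → Mixed) {c} → Run (subst l ρ) c →
      Σ (Fin m → G) λ as → (∀ j → InT (as j)) × (∀ j → Occurs j l → Run (ρ j) (as j)) ×
        Run (l ⟦ (λ j → var (as j)) ⟧) c
    run-subst⁻ {m} l ρ r = as , (λ j → proj₁ (proj₂ (state j))) , runs , run-abstract l r runs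
      where
        state : ∀ j → Σ G λ a → InT a × (Occurs j l → Run (ρ j) a)
        state j with occurs? j l
        ... | yes o = let (a , ra) = run-occurrence o r in a , run-InT ra , λ _ → ra
        ... | no ¬o = p , InT-p , λ o → ⊥-elim (¬o o)
        as : Fin m → G
        as j = proj₁ (state j)
        runs : ∀ j → Occurs j l → Run (ρ j) (as j)
        runs j = proj₂ (proj₂ (state j))

    mutual
      run-subst⁺ : ∀ {m} (l : Term (Fin m)) {ρ : Fin m → Mixed} {as : Fin m → G} {c} →
        Run (l ⟦ (λ j → var (as j)) ⟧) c → (∀ j → Run (ρ j) (as j)) → Run (subst l ρ) c
      run-subst⁺ (var j)     (run-var θ)         h = run-Θ (h j) θ
      run-subst⁺ (node f ls) (run-node rs it θ) h = run-node (runs-subst⁺ ls rs h) it θ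

      runs-subst⁺ : ∀ {m k} (ls : Vec (Term (Fin m)) k) {ρ : Fin m → Mixed} {as : Fin m → G} {bs} →
        Pointwise Run (substs ls (λ j → var (as j))) bs → (∀ j → Run (ρ j) (as j)) →
        Pointwise Run (substs ls ρ) bs
      runs-subst⁺ []       []       h = []
      runs-subst⁺ (l ∷ ls) (r ∷ rs) h = run-subst⁺ l r h ∷ runs-subst⁺ ls rs h

    embed-subst : ∀ {m} (l : Term (Fin m)) (σ : Fin m → G) → embed (l ⟦ σ ⟧) ≡ subst l (λ j → embed (σ j))
    embed-subst l σ = subst-subst l σ _

  module Trees (E : GTES {Sym}) (p q : G) (tree : G → G) (valid : Automaton.ValidTree E p q tree) where
    open Runs E p q

    tree-run : ∀ {t} → InT t → Run (embed (tree t)) t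
    tree-run {t} i = reaches→run (proj₁ valid t i)

    tree-⇔* : ∀ {t} → InT t → GStar E (tree t) t
    tree-⇔* i = run-sound-embed (tree-run i)

    run-tree-instance : ∀ {m} (l : Term (Fin m)) (as : Fin m → G) {a} → (∀ j → InT (as j)) →
      Reaches (l ⟦ (λ j → var (as j)) ⟧) a → Run (embed (l ⟦ (λ j → tree (as j)) ⟧)) a
    run-tree-instance l as inT reach = ≡-subst (λ x → Run x _) (sym (embed-subst l _))
      (run-subst⁺ l (reaches→run reach) (λ j → tree-run (inT j)))

  module Decisions (finite : FiniteAlphabet Sym) (E : GTES {Sym}) (p q : G)
                   (Ts : List G)
                   (Ts-complete : ∀ {t} → Automaton.InT E p q t → t ∈ Ts)
                   (Ts-sound : ∀ {t} → t ∈ Ts → Automaton.InT E p q t)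
                   (tree : G → G) (valid : Automaton.ValidTree E p q tree) where
    open Runs E p q
    open Trees E p q tree valid
    open DecidableEquality finite
    open DecMembership _≟_ using (_∈?_)

    InT? : ∀ t → Dec (InT t)
    InT? t = map′ Ts-sound Ts-complete (t ∈? Ts)

    -- Θ-classes are exactly the fibres of the tree function.
    Θ? : ∀ x y → Dec (Θ x y)
    Θ? x y with InT? x | InT? y
    ... | no ¬i | _     = no λ θ → ¬i (Θ-InTˡ θ)
    ... | yes _ | no ¬j = no λ θ → ¬j (Θ-InTʳ θ)
    ... | yes i | yes j with tree x ≟ tree y
    ...   | yes eq  = yes (run-det (≡-subst (λ t → Run (embed t) x) eq (tree-run i)) (tree-run j))
    ...   | no neq = no λ θ → neq (proj₂ valid x y θ)

    RuleFor : ∀ {m} → Sym m → Vec G m → G → Set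
    RuleFor {m} f as t = Σ (Vec G m) λ ts → t ≡ node f ts × Pointwise Θ as ts

    rule? : ∀ {m} (f : Sym m) (as : Vec G m) t → Dec (RuleFor f as t)
    rule? {m} f as (node {m'} g ts) with m Data.Nat.≟ m'
    ... | no m≢m' = no λ { (_ , refl , _) → m≢m' refl }
    ... | yes refl with f ≟ₛ g
    ...   | no f≢g = no λ { (_ , refl , _) → f≢g refl }
    ...   | yes refl with pointwise? Θ? as ts
    ...     | yes θs = yes (ts , refl , θs)
    ...     | no ¬θs = no λ { (_ , refl , θs) → ¬θs θs }

    mutual
      run? : (M : Mixed) → (Σ G λ c → Run M c) ⊎ (∀ c → ¬ Run M c)
      run? (var a) with InT? a
      ... | yes i = inj₁ (a , run-var (Θ-refl i))
      ... | no ¬i = inj₂ λ { c (run-var θ) → ¬i (Θ-InTˡ θ) }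
      run? (node f Ms) with runs? Ms
      ... | inj₂ none = inj₂ λ { c (run-node rs _ _) → none _ rs }
      ... | inj₁ (as , rs) with any? (rule? f as) Ts
      ...   | yes rule with find rule
      ...     | t , t∈ , ts , refl , θs =
                  inj₁ (t , run-node (pointwise-trans run-Θ rs θs) (Ts-sound t∈) (Θ-refl (Ts-sound t∈)))
      run? (node f Ms) | inj₁ (as , rs) | no ¬rule =
        inj₂ λ { c (run-node rs' it θ) → ¬rule (lose (Ts-complete it) (_ , refl , runs-det rs rs')) }

      runs? : ∀ {m} (Ms : Vec Mixed m) → (Σ (Vec G m) λ as → Pointwise Run Ms as) ⊎ (∀ as → ¬ Pointwise Run Ms as)
      runs? []       = inj₁ ([] , [])
      runs? (M ∷ Ms) with run? M | runs? Ms
      ... | inj₂ none     | _               = inj₂ λ { (a ∷ as) (r ∷ rs) → none a r }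
      ... | inj₁ _        | inj₂ none       = inj₂ λ { (a ∷ as) (r ∷ rs) → none as rs }
      ... | inj₁ (c , r)  | inj₁ (cs , rs)  = inj₁ (c ∷ cs , r ∷ rs)

    Run? : ∀ M c → Dec (Run M c)
    Run? M c with run? M
    ... | inj₂ none = no (none c)
    ... | inj₁ (c' , r) with Θ? c' c
    ...   | yes θ = yes (run-Θ r θ)
    ...   | no ¬θ = no λ r' → ¬θ (run-det r r')

    Reaches? : ∀ M c → Dec (Reaches M c)
    Reaches? M c with Run? M c
    ... | yes r = yes (run→reaches r)
    ... | no ¬r = no λ reach → ¬r (reaches→run reach)

    -- ⇔*_E is decided by comparing states: X ⇔*_E Y iff Y runs to the state of X.
    ⇔*? : ∀ {X b} → Run (embed X) b → ∀ Y → Dec (GStar E X Y)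
    ⇔*? {X} {b} rX Y with run? (embed Y)
    ... | inj₂ none = no λ X⇔*Y → none b (run-⇔* X⇔*Y rX)
    ... | inj₁ (c , rY) with Θ? c b
    ...   | yes θ = yes (run-sound-embed rX ◅◅ ⇔*-sym (run-sound-embed (run-Θ rY θ)))
    ...   | no ¬θ = no λ X⇔*Y → ¬θ (run-det rY (run-⇔* X⇔*Y rX))

    HasChild : (G → Set) → G → Set
    HasChild P (node f ts) = VAny P ts

    hasChild? : ∀ {P : G → Set} → Decidable P → Decidable (HasChild P)
    hasChild? P? (node f ts) = vany? P? ts

    hasChild-map : ∀ {P Q : G → Set} → (∀ {t} → P t → Q t) → ∀ {t} → HasChild P t → HasChild Q t
    hasChild-map P⊆Q {node f ts} = VAny-map P⊆Q

    Θ-args : ∀ {m} {f : Sym m} {ts} → InT (node f ts) → Pointwise Θ ts ts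
    Θ-args {ts = ts} i = go ts (λ s⊑ts → InT-⊑ (child s⊑ts) i)
      where
        go : ∀ {m} (ts : Vec G m) → (∀ {s} → VAny (s ⊑_) ts → InT s) → Pointwise Θ ts ts
        go []       inT = []
        go (t ∷ ts) inT = Θ-refl (inT (here refl⊑)) ∷ go ts (λ s⊑ts → inT (there s⊑ts))

    -- Reachability from the state a: 'Within n' is the set of states reachable in at
    -- most n rule applications above a.  It is decidable for each n and, since it
    -- grows inside the finite T, stabilises; the stable set decides ReachesFrom a.
    module Reachability (a : G) where

      Within : ℕ → G → Set
      Within zero    t = Θ a t
      Within (suc n) t = Within n t ⊎ Any (λ s → Θ s t × HasChild (Within n) s) Ts

      within? : ∀ n → Decidable (Within n)
      within? zero    t = Θ? a t
      within? (suc n) t = within? n t ⊎-dec any? (λ s → Θ? s t ×-dec hasChild? (within? n) s) Ts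

      within-InT : ∀ n {t} → Within n t → InT t
      within-InT zero    θ           = Θ-InTʳ θ
      within-InT (suc n) (inj₁ w)    = within-InT n w
      within-InT (suc n) (inj₂ step) = Θ-InTʳ (proj₁ (proj₂ (proj₂ (find step))))

      run→within : ∀ (c : Context G) {d} → Run (fill c (var a)) d → Σ ℕ λ n → Within n d
      run→within hole             (run-var θ) = 0 , θ
      run→within (down f i xs c) (run-node {ts = ts} rs it θ) with run→within c (proj₁ (≔-pointwise⁻ xs i rs))
      ... | n , w = suc n , inj₂ (lose (Ts-complete it) (θ , any-lookup ts i w))

      within→run : ∀ n {d} → Within n d → Σ (Context G) λ c → Run (fill c (var a)) d
      within→run zero    θ        = hole , run-var θ
      within→run (suc n) (inj₁ w) = within→run n w
      within→run (suc n) (inj₂ step) with find step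
      ... | node f ts , t∈ , θ , below with within→run n (lookup-index below)
      ...   | c , r = down f (index below) (map var ts) c ,
                      run-node (≔-pointwise⁺ (run-vars (Θ-args (Ts-sound t∈))) (index below) r) (Ts-sound t∈) θ

      Stable : ℕ → Set
      Stable n = ∀ {t} → Within (suc n) t → Within n t

      within-from-zero : ∀ m {t} → Within 0 t → Within m t
      within-from-zero zero    w = w
      within-from-zero (suc m) w = inj₁ (within-from-zero m w)

      stable-bound : ∀ {m} → Stable m → ∀ n {t} → Within n t → Within m t
      stable-bound {m} stable zero    w           = within-from-zero m w
      stable-bound     stable (suc n) (inj₁ w)    = stable-bound stable n w
      stable-bound     stable (suc n) (inj₂ step) =
        stable (inj₂ (Any-map (λ (θ , below) → θ , hasChild-map (stable-bound stable n) below) step))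

      stable-or-large : ∀ n → (Σ ℕ λ m → m < n × Stable m) ⊎ (n ≤ count (within? n) Ts)
      stable-or-large zero = inj₂ z≤n
      stable-or-large (suc n) with stable-or-large n
      ... | inj₁ (m , m<n , stable) = inj₁ (m , m≤n⇒m≤1+n m<n , stable)
      ... | inj₂ large with any? (λ t → within? (suc n) t ×-dec ¬? (within? n t)) Ts
      ...   | yes new = inj₂ (≤-trans (s≤s large) (count-strict (within? n) (within? (suc n)) inj₁ Ts new))
      ...   | no ¬new = inj₁ (n , ≤-refl , stable)
        where
          stable : Stable n
          stable {t} w with within? n t
          ... | yes w' = w'
          ... | no ¬w  = ⊥-elim (¬new (lose (Ts-complete (within-InT (suc n) w)) (w , ¬w)))

      stabilises : Σ ℕ Stable
      stabilises with stable-or-large (suc (length Ts))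
      ... | inj₁ (m , _ , stable) = m , stable
      ... | inj₂ large = ⊥-elim (<⇒≱ (s≤s ≤-refl) (≤-trans large (count≤length (within? _) Ts)))

      reachesFrom? : ∀ b → Dec (ReachesFrom a b)
      reachesFrom? b with stabilises
      ... | m , stable with within? m b
      ...   | yes w = yes (let (c , r) = within→run m w in reachesFrom c r)
      ...   | no ¬w = no λ (u , reach) → ¬w (bound u reach)
        where
          bound : ∀ u → Reaches (plug u (var a)) b → Within m b
          bound u reach with fromCtx (var a) u
          ... | c , eq with run→within c (≡-subst (λ x → Run x b) (eq (var a)) (reaches→run reach))
          ...   | n , w = stable-bound stable n w

  mutual
    matchVar : ∀ {m} → Term (Fin m) → G → Fin m → Maybe G
    matchVar (var i)     s           j with i Data.Fin.≟ j
    ... | yes _ = just s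
    ... | no _  = nothing
    matchVar (node f ls) (node g ss) j = matchVars ls ss j

    matchVars : ∀ {m a b} → Vec (Term (Fin m)) a → Vec G b → Fin m → Maybe G
    matchVars []       _        j = nothing
    matchVars (l ∷ ls) []       j = nothing
    matchVars (l ∷ ls) (s ∷ ss) j with matchVar l s j
    ... | just x  = just x
    ... | nothing = matchVars ls ss j

  mutual
    matchVar-sound : ∀ {m} (l : Term (Fin m)) (us : Fin m → G) j {x} →
      matchVar l (l ⟦ us ⟧) j ≡ just x → x ≡ us j
    matchVar-sound (var i)     us j eq with i Data.Fin.≟ j
    matchVar-sound (var i)     us j refl | yes refl = refl
    matchVar-sound (var i)     us j ()   | no _
    matchVar-sound (node f ls) us j eq = matchVars-sound ls us j eq

    matchVars-sound : ∀ {m a} (ls : Vec (Term (Fin m)) a) (us : Fin m → G) j {x} →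
      matchVars ls (substs ls us) j ≡ just x → x ≡ us j
    matchVars-sound []       us j ()
    matchVars-sound (l ∷ ls) us j eq with matchVar l (l ⟦ us ⟧) j in found
    matchVars-sound (l ∷ ls) us j refl | just y  = matchVar-sound l us j found
    matchVars-sound (l ∷ ls) us j eq   | nothing = matchVars-sound ls us j eq

  mutual
    matchVar-defined : ∀ {m} (l : Term (Fin m)) (us : Fin m → G) j → Occurs j l →
      Σ G λ x → matchVar l (l ⟦ us ⟧) j ≡ just x
    matchVar-defined (var i)     us j here with i Data.Fin.≟ j
    ... | yes _  = _ , refl
    ... | no i≢j = ⊥-elim (i≢j refl)
    matchVar-defined (node f ls) us j (there o) = matchVars-defined ls us j o

    matchVars-defined : ∀ {m a} (ls : Vec (Term (Fin m)) a) (us : Fin m → G) j → VAny (Occurs j) ls →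
      Σ G λ x → matchVars ls (substs ls us) j ≡ just x
    matchVars-defined (l ∷ ls) us j o with matchVar l (l ⟦ us ⟧) j in found
    ... | just y = y , refl
    matchVars-defined (l ∷ ls) us j (here o)  | nothing with matchVar-defined l us j o
    ... | x , found' with () ← trans (sym found) found'
    matchVars-defined (l ∷ ls) us j (there o) | nothing = matchVars-defined ls us j o

  match : ∀ {m} → Term (Fin m) → G → Fin m → G
  match l s j = fromMaybe s (matchVar l s j)

  match-instance : ∀ {m} (l : Term (Fin m)) (us : Fin m → G) j → Occurs j l → match l (l ⟦ us ⟧) j ≡ us j
  match-instance l us j o with matchVar-defined l us j o
  ... | x , found = trans (cong (fromMaybe _) found) (matchVar-sound l us j found)

  subtermsPQ : G → G → List G
  subtermsPQ p q = subterms p ++ subterms q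

  ∈-subtermsPQ⁺ : ∀ {p q s} → s ⊑ p ⊎ s ⊑ q → s ∈ subtermsPQ p q
  ∈-subtermsPQ⁺     (inj₁ s⊑p) = ∈-++⁺ˡ (∈-subterms⁺ s⊑p)
  ∈-subtermsPQ⁺ {p} (inj₂ s⊑q) = ∈-++⁺ʳ (subterms p) (∈-subterms⁺ s⊑q)

  ∈-subtermsPQ⁻ : ∀ {s} p q → s ∈ subtermsPQ p q → s ⊑ p ⊎ s ⊑ q
  ∈-subtermsPQ⁻ p q s∈ with ∈-++⁻ (subterms p) s∈
  ... | inj₁ s∈p = inj₁ (∈-subterms⁻ p s∈p)
  ... | inj₂ s∈q = inj₂ (∈-subterms⁻ q s∈q)

  record Listing (E : GTES {Sym}) : Set where
    field
      pairs    : List (G × G)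
      complete : ∀ {l r} → E l r → (l , r) ∈ pairs
      sound    : ∀ {l r} → (l , r) ∈ pairs → E l r

  module TermsOf {E : GTES {Sym}} (p q : G) (L : Listing E) where
    open Listing L
    open Automaton E p q using (InT)

    sides : G × G → List G
    sides (l , r) = subterms l ++ subterms r

    T-list : List G
    T-list = subtermsPQ p q ++ concatMap sides pairs

    T-complete : ∀ {t} → InT t → t ∈ T-list
    T-complete (inj₁ t⊑p)        = ∈-++⁺ˡ (∈-subtermsPQ⁺ (inj₁ t⊑p))
    T-complete (inj₂ (inj₁ t⊑q)) = ∈-++⁺ˡ (∈-subtermsPQ⁺ {p} (inj₂ t⊑q))
    T-complete {t} (inj₂ (inj₂ (l , r , e , t⊑))) = ∈-++⁺ʳ _ (∈-concatMap⁺ sides (lose (complete e) (side t⊑)))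
      where
        side : t ⊑ l ⊎ t ⊑ r → t ∈ sides (l , r)
        side (inj₁ t⊑l) = ∈-++⁺ˡ (∈-subterms⁺ t⊑l)
        side (inj₂ t⊑r) = ∈-++⁺ʳ (subterms l) (∈-subterms⁺ t⊑r)

    T-sound : ∀ {t} → t ∈ T-list → InT t
    T-sound t∈ with ∈-++⁻ (subtermsPQ p q) t∈
    ... | inj₁ t∈pq with ∈-subtermsPQ⁻ p q t∈pq
    ...   | inj₁ t⊑p = inj₁ t⊑p
    ...   | inj₂ t⊑q = inj₂ (inj₁ t⊑q)
    T-sound t∈ | inj₂ t∈sides with find (∈-concatMap⁻ sides {xs = pairs} t∈sides)
    ... | (l , r) , lr∈ , t∈lr with ∈-++⁻ (subterms l) t∈lr
    ...   | inj₁ t∈l = inj₂ (inj₂ (l , r , sound lr∈ , inj₁ (∈-subterms⁻ l t∈l)))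
    ...   | inj₂ t∈r = inj₂ (inj₂ (l , r , sound lr∈ , inj₂ (∈-subterms⁻ r t∈r)))

  pairOf : (e : Equation {Sym}) → (Fin (Equation.arity e) → G) → G × G
  pairOf e σ = Equation.lhs e ⟦ σ ⟧ , Equation.rhs e ⟦ σ ⟧

  -- Collecting the instances pairOf e (F e x) for e ∈ S and the x ∈ Xs e satisfying
  -- a decidable condition; both W₁ and the new equations of W_{i+1} are of this form.
  module Gather (S : TES {Sym}) {X : Equation {Sym} → Set} (Xs : ∀ e → List (X e))
                {P : ∀ e → X e → Set} (P? : ∀ e → Decidable (P e))
                (F : ∀ e → X e → Fin (Equation.arity e) → G) where

    instancesOf : Equation {Sym} → List (G × G)
    instancesOf e = mapᴸ (λ x → pairOf e (F e x)) (filter (P? e) (Xs e))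

    gather : List (G × G)
    gather = concatMap instancesOf S

    ∈-gather⁺ : ∀ {e x} → e ∈ S → x ∈ Xs e → P e x → pairOf e (F e x) ∈ gather
    ∈-gather⁺ e∈S x∈ px = ∈-concatMap⁺ instancesOf (lose e∈S (∈-map⁺ _ (∈-filter⁺ (P? _) x∈ px)))

    ∈-gather⁻ : ∀ {y} → y ∈ gather →
      Σ (Equation {Sym}) λ e → e ∈ S × Σ (X e) λ x → x ∈ Xs e × P e x × y ≡ pairOf e (F e x)
    ∈-gather⁻ y∈ with find (∈-concatMap⁻ instancesOf {xs = S} y∈)
    ... | e , e∈S , y∈e with ∈-map⁻ (λ x → pairOf e (F e x)) y∈e
    ...   | x , x∈ , refl =
      let (x∈Xs , px) = ∈-filter⁻ (P? e) {xs = Xs e} x∈ in e , e∈S , x , x∈Xs , px , refl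

  module Sequence (finite : FiniteAlphabet Sym) (S : TES {Sym}) (VP : All VarPreserving S) (p q : G)
                  (tr : ℕ → G → G) (valid : ∀ k → Automaton.ValidTree (W S p q tr k) p q (tr k)) where
    open DecidableEquality finite using (_≟_)
    open Equation

    -- Indices are shifted by one: Wₖ k is the system W_{k+1}.
    Wₖ : ℕ → GTES {Sym}
    Wₖ = W S p q tr

    W-mono : ∀ {d k} → d ≤′ k → ∀ {l r} → Wₖ d l r → Wₖ k l r
    W-mono ≤′-refl        w = w
    W-mono (≤′-step d≤k) w = inj₁ (W-mono d≤k w)

    sideOf : (e : Equation {Sym}) → Bool → Term (Fin (arity e))
    sideOf e true  = lhs e
    sideOf e false = rhs e

    -- By variable preservation, an instance of an equation of S is determined by the
    -- substitution on the variables of either side.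
    pairOf-cong : ∀ {e} → e ∈ S → (side : Bool) {σ τ : Fin (arity e) → G} →
      (∀ j → Occurs j (sideOf e side) → σ j ≡ τ j) → pairOf e σ ≡ pairOf e τ
    pairOf-cong {e} e∈S true  eq = cong₂ _,_ (subst-cong (lhs e) eq)
                                             (subst-cong (rhs e) λ j o → eq j (proj₂ (lookupₐ VP e∈S j) o))
    pairOf-cong {e} e∈S false eq = cong₂ _,_ (subst-cong (lhs e) λ j o → eq j (proj₁ (lookupₐ VP e∈S j) o))
                                             (subst-cong (rhs e) eq)

    -- W₁ is finite: its equations are the instances of S obtained by matching one
    -- side against a subterm s of p or q, whenever the match reproduces s.
    module First where

      Matches : (e : Equation {Sym}) → G × Bool → Set
      Matches e (s , side) = sideOf e side ⟦ match (sideOf e side) s ⟧ ≡ s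

      open Gather S (λ _ → cartesianProduct (subtermsPQ p q) (true ∷ false ∷ [])) {P = Matches}
                  (λ e (s , side) → (sideOf e side ⟦ match (sideOf e side) s ⟧) ≟ s)
                  (λ e (s , side) → match (sideOf e side) s)

      complete-side : ∀ {e} → e ∈ S → ∀ side us → side ∈ true ∷ false ∷ [] →
        SubPQ S p q (sideOf e side ⟦ us ⟧) → pairOf e us ∈ gather
      complete-side {e} e∈S side us side∈ subPQ =
        ≡-subst (_∈ gather) (pairOf-cong e∈S side (match-instance (sideOf e side) us))
          (∈-gather⁺ e∈S (∈-cartesianProduct⁺ (∈-subtermsPQ⁺ subPQ) side∈)
            (subst-cong (sideOf e side) (match-instance (sideOf e side) us)))

      listing : Listing (Wₖ 0)
      listing = record { pairs = gather ; complete = complete ; sound = sound }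
        where
          complete : ∀ {l r} → Wₖ 0 l r → (l , r) ∈ gather
          complete (e , e∈S , us , refl , refl , inj₁ subPQ) = complete-side e∈S true  us (hereₗ refl) subPQ
          complete (e , e∈S , us , refl , refl , inj₂ subPQ) = complete-side e∈S false us (thereₗ (hereₗ refl)) subPQ

          sound : ∀ {l r} → (l , r) ∈ gather → Wₖ 0 l r
          sound lr∈ with ∈-gather⁻ lr∈
          ... | e , e∈S , (s , side) , x∈ , matches , refl with ∈-cartesianProduct⁻ (subtermsPQ p q) _ x∈
          ...   | s∈ , _ = e , e∈S , _ , refl , refl , which side matches
            where
              which : ∀ side → Matches e (s , side) →
                SubPQ S p q (lhs e ⟦ match (sideOf e side) s ⟧) ⊎ SubPQ S p q (rhs e ⟦ match (sideOf e side) s ⟧)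
              which true  matches = inj₁ (≡-subst (SubPQ S p q) (sym matches) (∈-subtermsPQ⁻ p q s∈))
              which false matches = inj₂ (≡-subst (SubPQ S p q) (sym matches) (∈-subtermsPQ⁻ p q s∈))

    -- From a listing of W_{k+1} (index k), everything about its automaton is decidable,
    -- hence so is each condition defining the new equations; this lists W_{k+2}.
    module NextLevel (k : ℕ) (L : Listing (Wₖ k)) where
      open TermsOf p q L
      open Runs (Wₖ k) p q
      open Trees (Wₖ k) p q (tr k) (valid k)
      open Decisions finite (Wₖ k) p q T-list T-complete T-sound (tr k) (valid k)

      Old : (e : Equation {Sym}) → (Fin (arity e) → G) → Set
      Old e as = GStar (Wₖ k) (lhs e ⟦ (λ j → tr k (as j)) ⟧) (rhs e ⟦ (λ j → tr k (as j)) ⟧)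

      SideReaches : (e : Equation {Sym}) → (Fin (arity e) → G) → G → Set
      SideReaches e as a = Reaches (lhs e ⟦ (λ j → var (as j)) ⟧) a ⊎ Reaches (rhs e ⟦ (λ j → var (as j)) ⟧) a

      old? : ∀ e as {a} → (∀ j → InT (as j)) → SideReaches e as a → Dec (Old e as)
      old? e as inT (inj₁ reach) = ⇔*? (run-tree-instance (lhs e) as inT reach) _
      old? e as inT (inj₂ reach) = map′ ⇔*-sym ⇔*-sym (⇔*? (run-tree-instance (rhs e) as inT reach) _)

      -- An instance satisfying (1) and (2) is either already W_{k+1}-equivalent or a new
      -- equation of W_{k+2}; in both cases its sides are ⇔*-related in W_{k+2}.
      instance-⇔* : ∀ {e} → e ∈ S → ∀ as a → (∀ j → InT (as j)) → InT a → SideReaches e as a →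
        (ReachesFrom a p ⊎ ReachesFrom a q) → GStar (Wₖ (suc k)) (lhs e ⟦ (λ j → tr k (as j)) ⟧) (rhs e ⟦ (λ j → tr k (as j)) ⟧)
      instance-⇔* {e} e∈S as a inT ia reach from with old? e as inT reach
      ... | yes old = ⇔*-mono inj₁ old
      ... | no ¬old = Rewriting.⇔-axiom (Wₖ (suc k)) (inj₂ (e , e∈S , as , a , inT , ia , reach , from , ¬old , refl , refl)) ◅ ε

      NewAt : (e : Equation {Sym}) → (Fin (arity e) → G) → G → Set
      NewAt e as a = (∀ j → InT (as j)) × InT a × SideReaches e as a × (ReachesFrom a p ⊎ ReachesFrom a q) × ¬ Old e as

      New : (e : Equation {Sym}) → Vec G (arity e) × G → Set
      New e (v , a) = NewAt e (lookup v) a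

      new? : ∀ e x → Dec (New e x)
      new? e (v , a) with all? (λ j → InT? (lookup v j)) | InT? a
      ... | no ¬inT | _     = no λ new → ¬inT (proj₁ new)
      ... | yes _   | no ¬ia = no λ new → ¬ia (proj₁ (proj₂ new))
      ... | yes inT | yes ia with Reaches? (lhs e ⟦ (λ j → var (lookup v j)) ⟧) a ⊎-dec Reaches? (rhs e ⟦ (λ j → var (lookup v j)) ⟧) a
                               | Reachability.reachesFrom? a p ⊎-dec Reachability.reachesFrom? a q
      ...   | no ¬reach | _        = no λ new → ¬reach (proj₁ (proj₂ (proj₂ new)))
      ...   | yes _     | no ¬from = no λ new → ¬from (proj₁ (proj₂ (proj₂ (proj₂ new))))
      ...   | yes reach | yes from with old? e (lookup v) inT reach
      ...     | yes old = no λ new → proj₂ (proj₂ (proj₂ (proj₂ new))) old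
      ...     | no ¬old = yes (inT , ia , reach , from , ¬old)

      new-cong : ∀ {e a} {as bs : Fin (arity e) → G} → (∀ j → as j ≡ bs j) → NewAt e as a → NewAt e bs a
      new-cong {e} {a} {as} {bs} as≗bs (inT , ia , reach , from , ¬old) =
        (λ j → ≡-subst InT (as≗bs j) (inT j)) , ia , reach′ reach , from ,
        λ old → ¬old (subst₂ (GStar (Wₖ k)) (sym (trees (lhs e))) (sym (trees (rhs e))) old)
        where
          states : ∀ t → t ⟦ (λ j → var (as j)) ⟧ ≡ t ⟦ (λ j → var (bs j)) ⟧
          states t = subst-cong t λ j _ → cong var (as≗bs j)
          trees : ∀ t → t ⟦ (λ j → tr k (as j)) ⟧ ≡ t ⟦ (λ j → tr k (bs j)) ⟧
          trees t = subst-cong t λ j _ → cong (tr k) (as≗bs j)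
          reach′ : SideReaches e as a → SideReaches e bs a
          reach′ (inj₁ r) = inj₁ (≡-subst (λ x → Reaches x a) (states (lhs e)) r)
          reach′ (inj₂ r) = inj₂ (≡-subst (λ x → Reaches x a) (states (rhs e)) r)

      open Gather S (λ e → cartesianProduct (vectors T-list (arity e)) T-list) {P = New} new?
                  (λ e (v , a) j → tr k (lookup v j))

      next : Listing (Wₖ (suc k))
      next = record { pairs = Listing.pairs L ++ gather ; complete = complete ; sound = sound }
        where
          complete : ∀ {l r} → Wₖ (suc k) l r → (l , r) ∈ Listing.pairs L ++ gather
          complete (inj₁ w) = ∈-++⁺ˡ (Listing.complete L w)
          complete (inj₂ (e , e∈S , as , a , inT , ia , reach , from , ¬old , refl , refl)) =
            ∈-++⁺ʳ _ (≡-subst (_∈ gather) same-pair (∈-gather⁺ e∈S v∈ (new-cong {e} as≗v (inT , ia , reach , from , ¬old))))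
            where
              v = tabulate as
              as≗v : ∀ j → as j ≡ lookup v j
              as≗v j = sym (lookup∘tabulate as j)
              v∈ : (v , a) ∈ cartesianProduct (vectors T-list (arity e)) T-list
              v∈ = ∈-cartesianProduct⁺ (∈-vectors v λ j → ≡-subst (_∈ T-list) (as≗v j) (T-complete (inT j))) (T-complete ia)
              same-pair : pairOf e (λ j → tr k (lookup v j)) ≡ pairOf e (λ j → tr k (as j))
              same-pair = cong₂ _,_ (subst-cong (lhs e) λ j _ → cong (tr k) (sym (as≗v j)))
                                    (subst-cong (rhs e) λ j _ → cong (tr k) (sym (as≗v j)))

          sound : ∀ {l r} → (l , r) ∈ Listing.pairs L ++ gather → Wₖ (suc k) l r
          sound lr∈ with ∈-++⁻ (Listing.pairs L) lr∈
          ... | inj₁ lr∈L = inj₁ (Listing.sound L lr∈L)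
          ... | inj₂ lr∈new with ∈-gather⁻ lr∈new
          ...   | e , e∈S , (v , a) , _ , (inT , ia , reach , from , ¬old) , refl =
                    inj₂ (e , e∈S , lookup v , a , inT , ia , reach , from , ¬old , refl , refl)

    listing : ∀ k → Listing (Wₖ k)
    listing zero    = First.listing
    listing (suc k) = NextLevel.next k (listing k)

    Endpoint : G → Set
    Endpoint z = z ≡ p ⊎ z ≡ q

    endpoint-⊑ : ∀ {z s} → Endpoint z → s ⊑ z → SubPQ S p q s
    endpoint-⊑ (inj₁ refl) s⊑p = inj₁ s⊑p
    endpoint-⊑ (inj₂ refl) s⊑q = inj₂ s⊑q

    module Step (k : ℕ) where
      open Runs (Wₖ k) p q
      open Trees (Wₖ k) p q (tr k) (valid k)
      open NextLevel k (listing k) using (instance-⇔*)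
      module Next = Rewriting (Wₖ (suc k))

      endpoint-InT : ∀ {z} → Endpoint z → InT z
      endpoint-InT (inj₁ refl) = InT-p
      endpoint-InT (inj₂ refl) = InT-q

      endpoint-from : ∀ {z a} → Endpoint z → ReachesFrom a z → ReachesFrom a p ⊎ ReachesFrom a q
      endpoint-from (inj₁ refl) from = inj₁ from
      endpoint-from (inj₂ refl) from = inj₂ from

      -- Rewriting u[Aσ] to u[Bσ], where u[Aσ] is W_{k+1}-equivalent to p or q: the run of
      -- p (or q) passes through a state b of Aσ, which is A[a₁,…,aₘ] →* b for states aⱼ
      -- of the σ(j), and σ(j) ⇔* tree(aⱼ).  The instance at the trees is then given.
      rewrite-step : ∀ {m} (A B : Term (Fin m)) → (∀ j → Occurs j B → Occurs j A) →
        (∀ as a → (∀ j → InT (as j)) → InT a → Reaches (A ⟦ (λ j → var (as j)) ⟧) a →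
           (ReachesFrom a p ⊎ ReachesFrom a q) →
           GStar (Wₖ (suc k)) (A ⟦ (λ j → tr k (as j)) ⟧) (B ⟦ (λ j → tr k (as j)) ⟧)) →
        ∀ {z} → Endpoint z → (u : Ctx ⊥) (σ : Fin m → G) → GStar (Wₖ k) z (plug u (A ⟦ σ ⟧)) →
        GStar (Wₖ (suc k)) (plug u (A ⟦ σ ⟧)) (plug u (B ⟦ σ ⟧))
      rewrite-step A B B⊆A at-trees {z} end u σ z⇔* with embed-plug u (A ⟦ σ ⟧)
      ... | c , eq with run-fill (embedᶜ c) (embed (A ⟦ σ ⟧))
                          (≡-subst (λ x → Run x z) (eq _) (run-⇔* z⇔* (run-self (endpoint-InT end))))
      ...   | b , rA , replace with run-subst⁻ A (λ j → embed (σ j)) (≡-subst (λ x → Run x b) (embed-subst A σ) rA)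
      ...     | as , inT , runs , rAs =
                Next.⇔*-plug u (⇔*-mono inj₁ (⇔*-subst A σ⇔tree) ◅◅ at-trees′ ◅◅
                                ⇔*-mono inj₁ (⇔*-sym (⇔*-subst B λ j o → σ⇔tree j (B⊆A j o))))
        where
          from : ReachesFrom b z
          from = reachesFrom (embedᶜ c) (replace (run-var (Θ-refl (run-InT rA))))
          at-trees′ : GStar (Wₖ (suc k)) (A ⟦ (λ j → tr k (as j)) ⟧) (B ⟦ (λ j → tr k (as j)) ⟧)
          at-trees′ = at-trees as b inT (run-InT rA) (run→reaches rAs) (endpoint-from end from)
          σ⇔tree : ∀ j → Occurs j A → GStar (Wₖ k) (σ j) (tr k (as j))
          σ⇔tree j o = run-sound-embed (runs j o) ◅◅ ⇔*-sym (tree-⇔* (inT j))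

      step : ∀ {z x y} → Endpoint z → GStar (Wₖ k) z x → StepS S x y → GStar (Wₖ (suc k)) x y
      step end z⇔*x (e , e∈S , u , us , inj₁ (refl , refl)) =
        rewrite-step (lhs e) (rhs e) (λ j → proj₂ (lookupₐ VP e∈S j))
          (λ as a inT ia reach from → instance-⇔* e∈S as a inT ia (inj₁ reach) from) end u us z⇔*x
      step end z⇔*x (e , e∈S , u , us , inj₂ (refl , refl)) =
        rewrite-step (rhs e) (lhs e) (λ j → proj₁ (lookupₐ VP e∈S j))
          (λ as a inT ia reach from → Next.⇔*-sym (instance-⇔* e∈S as a inT ia (inj₂ reach) from)) end u us z⇔*x

    -- The first step of a chain rewrites a subterm of p or q, so it is a W₁-step.
    first-step : ∀ {z t} → Endpoint z → StepS S z t → GStep (Wₖ 0) z t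
    first-step end (e , e∈S , u , us , inj₁ (refl , t≡)) =
      _ , _ , (e , e∈S , us , refl , refl , inj₁ (endpoint-⊑ end (⊑-plug u _))) , u , inj₁ (refl , t≡)
    first-step end (e , e∈S , u , us , inj₂ (refl , t≡)) =
      _ , _ , (e , e∈S , us , refl , refl , inj₂ (endpoint-⊑ end (⊑-plug u _))) , u , inj₂ (refl , t≡)

    -- Induction along a chain: after d further steps the current term is W_{d+1}-equivalent
    -- to the endpoint, so the next step is a W_{d+2}-equivalence.
    chain-from : ∀ k d {z x n} (ts : Vec G n) → Endpoint z → GStar (Wₖ d) z x → d + n ≤ k →
      Chain (StepS S) x ts → Chain (GStar (Wₖ k)) x ts
    chain-from k d []       end z⇔*x bound tt = tt
    chain-from k d {n = suc n} (t ∷ ts) end z⇔*x bound (x⇔t , rest) =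
      ⇔*-mono (W-mono (≤⇒≤′ (m+n≤o⇒m≤o (suc d) bound′))) x⇔*t ,
      chain-from k (suc d) ts end (⇔*-mono inj₁ z⇔*x ◅◅ x⇔*t) bound′ rest
      where
        x⇔*t : GStar (Wₖ (suc d)) _ t
        x⇔*t = Step.step d end z⇔*x x⇔t
        bound′ : suc d + n ≤ k
        bound′ = ≡-subst (_≤ k) (+-suc d n) bound

    chain : ∀ k {z n} (ts : Vec G n) → 1 ≤ n → n ≤ suc k → Endpoint z →
      Chain (StepS S) z ts → Chain (GStar (Wₖ k)) z ts
    chain k (t ∷ ts) _ (s≤s bound) end (z⇔t , rest) =
      ⇔*-mono (W-mono {0} {k} (≤⇒≤′ z≤n)) (first-step end z⇔t ◅ ε) ,
      chain-from k 0 ts end (first-step end z⇔t ◅ ε) bound rest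

mainTheorem5 : (Sym : ℕ → Set) → FiniteAlphabet Sym →
    (S : TES {Sym}) → All VarPreserving S →
    (p q : Ground Sym) →
    (tr : ℕ → Ground Sym → Ground Sym) →
    (∀ k → Automaton.ValidTree (W S p q tr k) p q (tr k)) →
    (k n : ℕ) → 1 ≤ n → n ≤ suc k → (ts : Vec (Ground Sym) n) →
    (Chain (StepS S) p ts → Chain (GStar (W S p q tr k)) p ts)
    × (Chain (StepS S) q ts → Chain (GStar (W S p q tr k)) q ts)
mainTheorem5 Sym finite S VP p q tr valid k n 1≤n n≤k+1 ts =
  chain k ts 1≤n n≤k+1 (inj₁ refl) , chain k ts 1≤n n≤k+1 (inj₂ refl)
  where open Sequence finite S VP p q tr valid
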